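{- For every integer $k\ge1$, the integrality gap of the following strengthened LP relaxation of $k$-CS-PIP (over all $k$-column sparse instances) is at least $2k-1$: $\max \sum_{i=1}^n w_ix_i$ subject to $\sum_{i=1}^n s_{ij}x_i\le c_j$ for all $j\in[m]$, $\sum_{i\in B(j)}x_i\le 1$ for all $j\in[m]$, and $0\le x_i\le 1$ for all $i\in[n]$. That is, $\sup \mathrm{LP}/\mathrm{OPT}\ge 2k-1$, the supremum being over $k$-column sparse instances with all capacities equal to $1$.
   Context: $k$-CS-PIP: given $w\in\mathbb{R}^n_+$, capacities $c\in\mathbb{R}^m_+$ and sizes $S=(s_{ij})\in\mathbb{R}^{m\times n}_+$ in which each column has at most $k$ nonzero entries, maximize $w^Tx$ subject to $Sx\le c$, $x\in\{0,1\}^n$; $\mathrm{OPT}$ denotes its optimum and $\mathrm{LP}$ the optimum of the relaxation. With capacities scaled to $c_j=1$, $B(j)=\{i\in[n]\mid s_{ij}>1/2\}$ is the set of items big for constraint $j$. -}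

module Defs where

open import Data.Nat as ℕ using (ℕ; zero; suc)
open import Data.Integer using (+_)
open import Data.Rational using (ℚ; 0ℚ; 1ℚ; ½; _+_; _*_; _-_; _≤_; _<_; _/_; _⊔_)
open import Data.Rational.Properties using (_≟_; _≤?_; _<?_)
open import Data.Fin using (Fin; zero; suc)
open import Data.Fin.Properties using (all?)
open import Data.Bool using (Bool; true; false; if_then_else_)
open import Data.List using (List; []; _∷_; map; concatMap; filterᵇ; foldr)
open import Relation.Nullary.Decidable using (⌊_⌋; does)
open import Function using (_∘_)
open import Data.Product using (_×_)
open import Data.Bool using (not)

ℕ→ℚ : ℕ → ℚ
ℕ→ℚ n = + n / 1

sumF : ∀ {n} → (Fin n → ℚ) → ℚ
sumF {zero}  f = 0ℚ
sumF {suc n} f = f zero + sumF (f ∘ suc)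

countF : ∀ {n} → (Fin n → Bool) → ℕ
countF {zero}  p = 0
countF {suc n} p = (if p zero then 1 else 0) ℕ.+ countF (p ∘ suc)

-- A k-CS-PIP instance with all capacities c_j = 1 (capacities scaled).
-- s j i is the size s_{ij} of item i in constraint j.
record Instance : Set where
  field
    m n : ℕ
    w   : Fin n → ℚ
    s   : Fin m → Fin n → ℚ

open Instance public

-- well-formed k-column-sparse instance: nonnegative data, each column has
-- at most k nonzero entries, and (standard normalisation) s_{ij} ≤ c_j = 1
KCSInstance : ℕ → Instance → Set
KCSInstance k I =
  (∀ i → 0ℚ ≤ w I i) × ((∀ j i → 0ℚ ≤ s I j i × s I j i ≤ 1ℚ) ×
  (∀ i → countF (λ j → not (does (s I j i ≟ 0ℚ))) ℕ.≤ k))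

value : (I : Instance) → (Fin (n I) → ℚ) → ℚ
value I x = sumF (λ i → w I i * x i)

load : (I : Instance) → (Fin (n I) → ℚ) → Fin (m I) → ℚ
load I x j = sumF (λ i → s I j i * x i)

isBig : (I : Instance) → Fin (m I) → Fin (n I) → Bool
isBig I j i = does (½ <? s I j i)

bigLoad : (I : Instance) → (Fin (n I) → ℚ) → Fin (m I) → ℚ
bigLoad I x j = sumF (λ i → if isBig I j i then x i else 0ℚ)

StrengthenedLPFeasible : (I : Instance) → (Fin (n I) → ℚ) → Set
StrengthenedLPFeasible I x =
  (∀ i → 0ℚ ≤ x i × x i ≤ 1ℚ) ×
  ((∀ j → load I x j ≤ 1ℚ) × (∀ j → bigLoad I x j ≤ 1ℚ))

toℚ : Bool → ℚ
toℚ true  = 1ℚ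
toℚ false = 0ℚ

assignments : (n : ℕ) → List (Fin n → Bool)
assignments zero    = (λ ()) ∷ []
assignments (suc n) =
  concatMap (λ b → map (λ f → λ { zero → b ; (suc i) → f i }) (assignments n))
            (true ∷ false ∷ [])

intFeasibleᵇ : (I : Instance) → (Fin (n I) → Bool) → Bool
intFeasibleᵇ I y = does (all? (λ j → load I (toℚ ∘ y) j ≤? 1ℚ))

-- OPT: maximum of w^T y over all feasible y ∈ {0,1}^n (the empty set y = 0
-- is always feasible, so starting the fold at 0 is harmless as w ≥ 0)
OPT : Instance → ℚ
OPT I = foldr _⊔_ 0ℚ
          (map (λ y → value I (toℚ ∘ y))
               (filterᵇ (intFeasibleᵇ I) (assignments (n I))))

module Submission where

-- Take N = 2k - 1 items of weight 1 and N constraints arranged on a cycle: item i has size 1 in constraint i and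
-- a small size δ in the k - 1 constraints that follow i cyclically, so each column has exactly k nonzeros. For any
-- two items, one lies among the k - 1 successors of the other, so some constraint would receive 1 + δ from the pair;
-- hence OPT = 1. Only the diagonal sizes exceed 1/2, so every B(j) is a singleton, and the uniform point
-- x_i = 1 - (N - 1) δ satisfies the strengthened LP with value N - N (N - 1) δ, which is at least (2k - 1) - ε once
-- δ is small enough.

open import Defs
open import Data.Bool using (Bool; true; false; if_then_else_; not)
open import Data.Empty using (⊥; ⊥-elim)
open import Data.Fin using (Fin; toℕ; zero; suc)
open import Data.Product using (Σ; _×_; _,_; proj₁; proj₂)
open import Data.Sum using (_⊎_; inj₁; inj₂; swap)
open import Function using (_∘_)
open import Relation.Binary.PropositionalEquality
open import Relation.Nullary using (Dec; yes; no; ¬_; does)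
open import Relation.Nullary.Decidable using (dec-true; dec-false)
import Data.Nat

dec-true⁻¹ : ∀ {a} {A : Set a} (a? : Dec A) → does a? ≡ true → A
dec-true⁻¹ (yes a) _ = a

module CyclicWindows where
  open import Data.Nat
  open import Data.Nat.Properties
  open import Relation.Binary.Definitions using (tri<; tri≈; tri>)
  open import Relation.Nullary.Decidable using (_×-dec_; _⊎-dec_)

  countF-cong : ∀ {n} {p q : Fin n → Bool} → p ≗ q → countF p ≡ countF q
  countF-cong {zero}  p≗q = refl
  countF-cong {suc n} p≗q = cong₂ _+_ (cong (λ b → if b then 1 else 0) (p≗q zero)) (countF-cong (p≗q ∘ suc))

  countF-mono : ∀ {n} {p q : Fin n → Bool} → (∀ j → p j ≡ true → q j ≡ true) → countF p ≤ countF q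
  countF-mono {zero}          p⇒q = z≤n
  countF-mono {suc n} {p} {q} p⇒q with p zero in p₀ | q zero in q₀
  ... | true  | true  = s≤s (countF-mono (p⇒q ∘ suc))
  ... | true  | false with () ← trans (sym (p⇒q zero p₀)) q₀
  ... | false | true  = m≤n⇒m≤1+n (countF-mono (p⇒q ∘ suc))
  ... | false | false = countF-mono (p⇒q ∘ suc)

  countRange : (ℕ → Bool) → ℕ → ℕ → ℕ
  countRange f a zero    = 0
  countRange f a (suc n) = (if f a then 1 else 0) + countRange f (suc a) n

  countF≡countRange : ∀ n a f → countF {n} (λ j → f (a + toℕ j)) ≡ countRange f a n
  countF≡countRange zero    a f = refl
  countF≡countRange (suc n) a f = cong₂ _+_
    (cong (λ i → if f i then 1 else 0) (+-identityʳ a))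
    (trans (countF-cong {n} (λ j → cong f (+-suc a (toℕ j)))) (countF≡countRange n (suc a) f))

  countRange-+ : ∀ f a x y → countRange f a (x + y) ≡ countRange f a x + countRange f (a + x) y
  countRange-+ f a zero    y = cong (λ b → countRange f b y) (sym (+-identityʳ a))
  countRange-+ f a (suc x) y = trans
    (cong ((if f a then 1 else 0) +_) (trans (countRange-+ f (suc a) x y)
      (cong (λ b → countRange f (suc a) x + countRange f b y) (sym (+-suc a x)))))
    (sym (+-assoc (if f a then 1 else 0) _ _))

  countRange≤length : ∀ f a n → countRange f a n ≤ n
  countRange≤length f a zero = z≤n
  countRange≤length f a (suc n) with f a
  ... | true  = s≤s (countRange≤length f (suc a) n)
  ... | false = m≤n⇒m≤1+n (countRange≤length f (suc a) n)

  TrueBelow : (ℕ → Bool) → ℕ → ℕ → ℕ → Set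
  TrueBelow f a n b = ∀ j → a ≤ j → j < a + n → f j ≡ true → j < b

  TrueBelow-suc : ∀ {f a n b} → TrueBelow f a (suc n) b → TrueBelow f (suc a) n b
  TrueBelow-suc {a = a} {n} below j a<j j<a+n = below j (<⇒≤ a<j) (subst (j <_) (sym (+-suc a n)) j<a+n)

  countRange≤∸ : ∀ f a n b → TrueBelow f a n b → countRange f a n ≤ b ∸ a
  countRange≤∸ f a zero    b below = z≤n
  countRange≤∸ f a (suc n) b below with f a in fa
  ... | false = ≤-trans (countRange≤∸ f (suc a) n b (TrueBelow-suc below)) (∸-monoʳ-≤ b (n≤1+n a))
  ... | true  with below a ≤-refl (m<m+n a z<s) fa
  ...   | s≤s {n = b′} a≤b′ = subst (suc (countRange f (suc a) n) ≤_) (sym (+-∸-assoc 1 a≤b′))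
                                 (s≤s (countRange≤∸ f (suc a) n (suc b′) (TrueBelow-suc below)))

  -- For N = 2k - 1 this says j ∈ {i, i + 1, …, i + k - 1} modulo N; the second disjunct is the wrap-around part.
  InWindow : ℕ → ℕ → ℕ → Set
  InWindow k i j = (i ≤ j × j < i + k) ⊎ j + k ≤ i

  inWindow? : ∀ k i j → Dec (InWindow k i j)
  inWindow? k i j = (i ≤? j ×-dec j <? i + k) ⊎-dec (j + k ≤? i)

  inWindowᵇ : ℕ → ℕ → ℕ → Bool
  inWindowᵇ k i j = does (inWindow? k i j)

  inWindow-refl : ∀ k′ i → InWindow (suc k′) i i
  inWindow-refl k′ i = inj₁ (≤-refl , m<m+n i z<s)

  inWindow-either-< : ∀ k {a b} → a < b → InWindow k a b ⊎ InWindow k b a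
  inWindow-either-< k {a} {b} a<b with b <? a + k
  ... | yes b<a+k = inj₁ (inj₁ (<⇒≤ a<b , b<a+k))
  ... | no  b≮a+k = inj₂ (inj₂ (≮⇒≥ b≮a+k))

  inWindow-either : ∀ k {a b} → a ≢ b → InWindow k a b ⊎ InWindow k b a
  inWindow-either k {a} {b} a≢b with <-cmp a b
  ... | tri< a<b _   _   = inWindow-either-< k a<b
  ... | tri≈ _   a≡b _   = ⊥-elim (a≢b a≡b)
  ... | tri> _   _   b<a = swap (inWindow-either-< k b<a)

  countRange-inWindow-below : ∀ k i → countRange (inWindowᵇ k i) 0 i ≤ suc i ∸ k
  countRange-inWindow-below k i = countRange≤∸ (inWindowᵇ k i) 0 i (suc i ∸ k) below
    where
    below : TrueBelow (inWindowᵇ k i) 0 i (suc i ∸ k)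
    below j _ j<i inW with dec-true⁻¹ (inWindow? k i j) inW
    ... | inj₁ (i≤j , _) = ⊥-elim (<⇒≱ j<i i≤j)
    ... | inj₂ j+k≤i     = m+n≤o⇒m≤o∸n (suc j) (s≤s j+k≤i)

  countRange-inWindow-from : ∀ k′ i n → countRange (inWindowᵇ (suc k′) i) i n ≤ suc k′
  countRange-inWindow-from k′ i n = subst (countRange f i n ≤_) (m+n∸m≡n i (suc k′)) (countRange≤∸ f i n (i + suc k′) below)
    where
    f : ℕ → Bool
    f = inWindowᵇ (suc k′) i
    below : TrueBelow f i n (i + suc k′)
    below j _ _ inW with dec-true⁻¹ (inWindow? (suc k′) i j) inW
    ... | inj₁ (_ , j<i+k) = j<i+k
    ... | inj₂ j+k≤i       = ≤-<-trans (m+n≤o⇒m≤o j j+k≤i) (m<m+n i z<s)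

  inWindow-count : ∀ k′ i → i < suc (k′ + k′) → countRange (inWindowᵇ (suc k′) i) 0 (suc (k′ + k′)) ≤ suc k′
  inWindow-count k′ i i<N = begin
    countRange f 0 N                          ≡⟨ cong (countRange f 0) (m+[n∸m]≡n (<⇒≤ i<N)) ⟨
    countRange f 0 (i + (N ∸ i))              ≡⟨ countRange-+ f 0 i (N ∸ i) ⟩
    countRange f 0 i + countRange f i (N ∸ i) ≤⟨ split (k ≤? suc i) ⟩
    k                                         ∎
    where
    open ≤-Reasoning
    k N : ℕ
    k = suc k′
    N = suc (k′ + k′)
    f : ℕ → Bool
    f = inWindowᵇ k i

    split : Dec (k ≤ suc i) → countRange f 0 i + countRange f i (N ∸ i) ≤ k
    split (yes k≤1+i) = begin
      countRange f 0 i + countRange f i (N ∸ i) ≤⟨ +-mono-≤ (countRange-inWindow-below k i) (countRange≤length f i (N ∸ i)) ⟩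
      (suc i ∸ k) + (N ∸ i)                     ≡⟨ +-∸-comm (N ∸ i) k≤1+i ⟨
      suc (i + (N ∸ i)) ∸ k                     ≡⟨ cong (λ m → suc m ∸ k) (m+[n∸m]≡n (<⇒≤ i<N)) ⟩
      suc N ∸ k                                 ≡⟨ cong (_∸ k′) (+-suc k′ k′) ⟨
      k′ + k ∸ k′                               ≡⟨ m+n∸m≡n k′ k ⟩
      k                                         ∎
    split (no k≰1+i) = begin
      countRange f 0 i + countRange f i (N ∸ i) ≤⟨ +-monoˡ-≤ _ (countRange-inWindow-below k i) ⟩
      (suc i ∸ k) + countRange f i (N ∸ i)      ≡⟨ cong (_+ countRange f i (N ∸ i)) (m≤n⇒m∸n≡0 (<⇒≤ (≰⇒> k≰1+i))) ⟩
      countRange f i (N ∸ i)                    ≤⟨ countRange-inWindow-from k′ i (N ∸ i) ⟩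
      k                                         ∎

  2*[1+n]∸1≡1+n+n : ∀ n → 2 * suc n ∸ 1 ≡ suc (n + n)
  2*[1+n]∸1≡1+n+n n = trans (cong (λ m → n + suc m) (+-identityʳ n)) (+-suc n n)

open CyclicWindows
open import Data.Nat as ℕ using (ℕ; zero; suc; _∸_)
import Data.Nat.Properties as ℕ
import Data.Integer as ℤ
import Data.Integer.Properties as ℤ
open import Data.Integer.Solver using (module +-*-Solver)
open import Data.Rational
open import Data.Rational.Properties
import Data.Rational.Unnormalised as ℚᵘ
import Data.Rational.Unnormalised.Properties as ℚᵘ
open import Data.Rational.Solver renaming (module +-*-Solver to ℚ-Solver)
open import Data.Fin.Properties using (all?; suc-injective; toℕ<n; toℕ-injective) renaming (_≟_ to _≟ᶠ_)
open import Data.List using ([]; _∷_; map; filterᵇ; foldr)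
open import Data.List.Relation.Unary.Any as Any using (Any; here; there)
open import Data.List.Relation.Unary.Any.Properties using (map⁺; ++⁺ˡ; ++⁺ʳ)

ℕ→ℚ-+ : ∀ a b → ℕ→ℚ (a ℕ.+ b) ≡ ℕ→ℚ a + ℕ→ℚ b
ℕ→ℚ-+ a b = toℚᵘ-injective (begin-equality
  toℚᵘ (ℕ→ℚ (a ℕ.+ b))                    ≃⟨ toℚᵘ-fromℚᵘ (ℚᵘ.mkℚᵘ (ℤ.+ (a ℕ.+ b)) 0) ⟩
  ℚᵘ.mkℚᵘ (ℤ.+ (a ℕ.+ b)) 0                ≃⟨ ℚᵘ.*≡* numerators ⟩
  ℚᵘ.mkℚᵘ (ℤ.+ a) 0 ℚᵘ.+ ℚᵘ.mkℚᵘ (ℤ.+ b) 0 ≃⟨ ℚᵘ.+-cong (toℚᵘ-fromℚᵘ (ℚᵘ.mkℚᵘ (ℤ.+ a) 0))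
                                                         (toℚᵘ-fromℚᵘ (ℚᵘ.mkℚᵘ (ℤ.+ b) 0)) ⟨
  toℚᵘ (ℕ→ℚ a) ℚᵘ.+ toℚᵘ (ℕ→ℚ b)           ≃⟨ toℚᵘ-homo-+ (ℕ→ℚ a) (ℕ→ℚ b) ⟨
  toℚᵘ (ℕ→ℚ a + ℕ→ℚ b)                     ∎)
  where
  open ℚᵘ.≤-Reasoning
  open +-*-Solver
  numerators : ℤ.+ (a ℕ.+ b) ℤ.* (ℤ.1ℤ ℤ.* ℤ.1ℤ) ≡ (ℤ.+ a ℤ.* ℤ.1ℤ ℤ.+ ℤ.+ b ℤ.* ℤ.1ℤ) ℤ.* ℤ.1ℤ
  numerators = trans (cong (ℤ._* (ℤ.1ℤ ℤ.* ℤ.1ℤ)) (ℤ.pos-+ a b))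
    (solve 2 (λ x y → (x :+ y) :* (con ℤ.1ℤ :* con ℤ.1ℤ) := (x :* con ℤ.1ℤ :+ y :* con ℤ.1ℤ) :* con ℤ.1ℤ)
           refl (ℤ.+ a) (ℤ.+ b))

ℕ→ℚ-suc : ∀ n → ℕ→ℚ (suc n) ≡ 1ℚ + ℕ→ℚ n
ℕ→ℚ-suc = ℕ→ℚ-+ 1

ℕ→ℚ-nonNeg : ∀ n → 0ℚ ≤ ℕ→ℚ n
ℕ→ℚ-nonNeg n = nonNegative⁻¹ (ℕ→ℚ n) {{normalize-nonNeg n 1}}

0≤1 : 0ℚ ≤ 1ℚ
0≤1 = ≤ᵇ⇒≤ _

½≤1 : ½ ≤ 1ℚ
½≤1 = ≤ᵇ⇒≤ _

<⇒≱ : ∀ {p q} → p < q → ¬ q ≤ p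
<⇒≱ p<q q≤p = <-irrefl refl (<-≤-trans p<q q≤p)

p≤p+q : ∀ p {q} → 0ℚ ≤ q → p ≤ p + q
p≤p+q p {q} 0≤q = subst (_≤ p + q) (+-identityʳ p) (+-monoʳ-≤ p 0≤q)

p≤q+p : ∀ p {q} → 0ℚ ≤ q → p ≤ q + p
p≤q+p p {q} 0≤q = subst (_≤ q + p) (+-identityˡ p) (+-monoˡ-≤ p 0≤q)

p≤q*p : ∀ {p q} → 0ℚ ≤ p → 1ℚ ≤ q → p ≤ q * p
p≤q*p {p} {q} 0≤p 1≤q = subst (_≤ q * p) (*-identityˡ p) (*-monoʳ-≤-nonNeg p {{nonNegative 0≤p}} 1≤q)

1≤ℕ→ℚ-suc : ∀ n → 1ℚ ≤ ℕ→ℚ (suc n)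
1≤ℕ→ℚ-suc n = subst (1ℚ ≤_) (sym (ℕ→ℚ-suc n)) (p≤p+q 1ℚ (ℕ→ℚ-nonNeg n))

+-nonNeg : ∀ {p q} → 0ℚ ≤ p → 0ℚ ≤ q → 0ℚ ≤ p + q
+-nonNeg {p} {q} 0≤p 0≤q = subst (_≤ p + q) (+-identityʳ 0ℚ) (+-mono-≤ 0≤p 0≤q)

*-nonNeg : ∀ {p q} → 0ℚ ≤ p → 0ℚ ≤ q → 0ℚ ≤ p * q
*-nonNeg {p} {q} 0≤p 0≤q =
  nonNegative⁻¹ (p * q) {{nonNeg*nonNeg⇒nonNeg p {{nonNegative 0≤p}} q {{nonNegative 0≤q}}}}

0<⊓ : ∀ {p q} → 0ℚ < p → 0ℚ < q → 0ℚ < p ⊓ q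
0<⊓ {p} {q} 0<p 0<q with ⊓-sel p q
... | inj₁ p⊓q≡p rewrite p⊓q≡p = 0<p
... | inj₂ p⊓q≡q rewrite p⊓q≡q = 0<q

toℚ-nonNeg : ∀ b → 0ℚ ≤ toℚ b
toℚ-nonNeg true  = 0≤1
toℚ-nonNeg false = ≤-refl

sumF-cong : ∀ {n} {f g : Fin n → ℚ} → f ≗ g → sumF f ≡ sumF g
sumF-cong {zero}  f≗g = refl
sumF-cong {suc n} f≗g = cong₂ _+_ (f≗g zero) (sumF-cong (f≗g ∘ suc))

sumF-mono : ∀ {n} {f g : Fin n → ℚ} → (∀ i → f i ≤ g i) → sumF f ≤ sumF g
sumF-mono {zero}  f≤g = ≤-refl
sumF-mono {suc n} f≤g = +-mono-≤ (f≤g zero) (sumF-mono (f≤g ∘ suc))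

sumF-nonNeg : ∀ {n} {f : Fin n → ℚ} → (∀ i → 0ℚ ≤ f i) → 0ℚ ≤ sumF f
sumF-nonNeg {zero}  0≤f = ≤-refl
sumF-nonNeg {suc n} 0≤f = +-nonNeg (0≤f zero) (sumF-nonNeg (0≤f ∘ suc))

sumF-const : ∀ n a → sumF {n} (λ _ → a) ≡ ℕ→ℚ n * a
sumF-const zero    a = sym (*-zeroˡ a)
sumF-const (suc n) a = begin
  a + sumF {n} (λ _ → a)   ≡⟨ cong (a +_) (sumF-const n a) ⟩
  a + ℕ→ℚ n * a            ≡⟨ solve 2 (λ a q → a :+ q :* a := (con 1ℚ :+ q) :* a) refl a (ℕ→ℚ n) ⟩
  (1ℚ + ℕ→ℚ n) * a         ≡⟨ cong (_* a) (ℕ→ℚ-suc n) ⟨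
  ℕ→ℚ (suc n) * a          ∎
  where open ≡-Reasoning; open ℚ-Solver

sumF-zero : ∀ {n} {f : Fin n → ℚ} → (∀ i → f i ≡ 0ℚ) → sumF f ≡ 0ℚ
sumF-zero {n} f≡0 = trans (sumF-cong f≡0) (trans (sumF-const n 0ℚ) (*-zeroʳ (ℕ→ℚ n)))

sumF-≤-const : ∀ {n} {f : Fin n → ℚ} {d} → (∀ i → f i ≤ d) → sumF f ≤ ℕ→ℚ n * d
sumF-≤-const {n} {d = d} f≤d = subst (_ ≤_) (sumF-const n d) (sumF-mono f≤d)

sumF-≤-except : ∀ {n} {f : Fin (suc n) → ℚ} {d e} a → f a ≤ e → (∀ i → i ≢ a → f i ≤ d) →
                sumF f ≤ e + ℕ→ℚ n * d
sumF-≤-except zero fa≤e f≤d = +-mono-≤ fa≤e (sumF-≤-const (λ i → f≤d (suc i) λ ()))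
sumF-≤-except {suc n} {f} {d} {e} (suc a) fa≤e f≤d = begin
  f zero + sumF (f ∘ suc)  ≤⟨ +-mono-≤ (f≤d zero λ ()) (sumF-≤-except a fa≤e (λ i i≢a → f≤d (suc i) (i≢a ∘ suc-injective))) ⟩
  d + (e + ℕ→ℚ n * d)      ≡⟨ solve 3 (λ d e q → d :+ (e :+ q :* d) := e :+ (con 1ℚ :+ q) :* d) refl d e (ℕ→ℚ n) ⟩
  e + (1ℚ + ℕ→ℚ n) * d     ≡⟨ cong (λ q → e + q * d) (ℕ→ℚ-suc n) ⟨
  e + ℕ→ℚ (suc n) * d      ∎
  where open ≤-Reasoning; open ℚ-Solver

sumF-≥-single : ∀ {n} {f : Fin n → ℚ} → (∀ i → 0ℚ ≤ f i) → ∀ a → f a ≤ sumF f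
sumF-≥-single {suc n} {f} 0≤f zero    = p≤p+q (f zero) (sumF-nonNeg (0≤f ∘ suc))
sumF-≥-single {suc n} {f} 0≤f (suc a) = subst (_≤ sumF f) (+-identityˡ (f (suc a)))
  (+-mono-≤ (0≤f zero) (sumF-≥-single (0≤f ∘ suc) a))

sumF-≥-pair : ∀ {n} {f : Fin n → ℚ} → (∀ i → 0ℚ ≤ f i) → ∀ {a b} → a ≢ b → f a + f b ≤ sumF f
sumF-≥-pair {suc n} 0≤f {zero}  {zero}  a≢b = ⊥-elim (a≢b refl)
sumF-≥-pair {suc n} {f} 0≤f {zero}  {suc b} a≢b = +-monoʳ-≤ (f zero) (sumF-≥-single (0≤f ∘ suc) b)
sumF-≥-pair {suc n} {f} 0≤f {suc a} {zero}  a≢b = subst (_≤ sumF f) (+-comm (f zero) (f (suc a)))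
  (+-monoʳ-≤ (f zero) (sumF-≥-single (0≤f ∘ suc) a))
sumF-≥-pair {suc n} {f} 0≤f {suc a} {suc b} a≢b = subst (_≤ sumF f) (+-identityˡ (f (suc a) + f (suc b)))
  (+-mono-≤ (0≤f zero) (sumF-≥-pair (0≤f ∘ suc) (a≢b ∘ cong suc)))

sumF-select : ∀ {n} (f : Fin n → ℚ) a → sumF (λ i → f i * toℚ (does (i ≟ᶠ a))) ≡ f a
sumF-select f zero = begin
  f zero * 1ℚ + sumF (λ i → f (suc i) * 0ℚ)   ≡⟨ cong₂ _+_ (*-identityʳ (f zero)) (sumF-zero (λ i → *-zeroʳ (f (suc i)))) ⟩
  f zero + 0ℚ                                 ≡⟨ +-identityʳ (f zero) ⟩
  f zero                                      ∎
  where open ≡-Reasoning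
sumF-select f (suc a) = begin
  f zero * 0ℚ + sumF (λ i → f (suc i) * toℚ (does (i ≟ᶠ a)))  ≡⟨ cong₂ _+_ (*-zeroʳ (f zero)) (sumF-select (f ∘ suc) a) ⟩
  0ℚ + f (suc a)                                            ≡⟨ +-identityˡ (f (suc a)) ⟩
  f (suc a)                                                 ∎
  where open ≡-Reasoning

AtMostOne : ∀ {n} → (Fin n → Bool) → Set
AtMostOne y = ∀ a b → y a ≡ true → y b ≡ true → a ≡ b

sumF-atMostOne : ∀ {n} (y : Fin n → Bool) → AtMostOne y → sumF (toℚ ∘ y) ≤ 1ℚ
sumF-atMostOne {zero}  y unique = 0≤1
sumF-atMostOne {suc n} y unique with y zero in y₀
... | true  = ≤-reflexive (trans (cong (1ℚ +_) (sumF-zero rest)) (+-identityʳ 1ℚ))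
  where
  rest : ∀ i → toℚ (y (suc i)) ≡ 0ℚ
  rest i with y (suc i) in yᵢ
  ... | true  with () ← unique zero (suc i) y₀ yᵢ
  ... | false = refl
... | false = subst (_≤ 1ℚ) (sym (+-identityˡ _))
  (sumF-atMostOne (y ∘ suc) (λ a b ya yb → suc-injective (unique (suc a) (suc b) ya yb)))

module _ {A : Set} (p : A → Bool) (g : A → ℚ) where

  foldr-⊔-filter-≤ : ∀ {b} → 0ℚ ≤ b → (∀ y → p y ≡ true → g y ≤ b) →
                     ∀ xs → foldr _⊔_ 0ℚ (map g (filterᵇ p xs)) ≤ b
  foldr-⊔-filter-≤ 0≤b g≤b []       = 0≤b
  foldr-⊔-filter-≤ 0≤b g≤b (x ∷ xs) with p x in px
  ... | true  = ⊔-lub (g≤b x px) (foldr-⊔-filter-≤ 0≤b g≤b xs)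
  ... | false = foldr-⊔-filter-≤ 0≤b g≤b xs

  ≤-foldr-⊔-filter : ∀ {v} xs → Any (λ y → p y ≡ true × v ≤ g y) xs →
                     v ≤ foldr _⊔_ 0ℚ (map g (filterᵇ p xs))
  ≤-foldr-⊔-filter (x ∷ xs) (here (px , v≤gx)) rewrite px = ≤-trans v≤gx (p≤p⊔q (g x) _)
  ≤-foldr-⊔-filter (x ∷ xs) (there v≤) with p x
  ... | true  = ≤-trans (≤-foldr-⊔-filter xs v≤) (p≤q⊔p (g x) _)
  ... | false = ≤-foldr-⊔-filter xs v≤

assignments-complete : ∀ n (y : Fin n → Bool) → Any (_≗ y) (assignments n)
assignments-complete zero    y = here (λ ())
assignments-complete (suc n) y = byHead (y zero) refl
  where
  -- The extension maps inside assignments are anonymous pattern lambdas, so they enter only through their equations.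
  extend : ∀ {b} {F : (Fin n → Bool) → Fin (suc n) → Bool} →
           (∀ z → F z zero ≡ b) → (∀ z i → F z (suc i) ≡ z i) → y zero ≡ b →
           ∀ {zs} → Any (_≗ y ∘ suc) zs → Any (_≗ y) (map F zs)
  extend {F = F} F₀ F₊ y₀ = map⁺ ∘ Any.map extend₁
    where
    extend₁ : ∀ {z} → z ≗ y ∘ suc → F z ≗ y
    extend₁ z≗y zero    = trans (F₀ _) (sym y₀)
    extend₁ z≗y (suc i) = trans (F₊ _ i) (z≗y i)

  byHead : ∀ b → y zero ≡ b → Any (_≗ y) (assignments (suc n))
  byHead true  y₀ = ++⁺ˡ (extend (λ _ → refl) (λ _ _ → refl) y₀ (assignments-complete n (y ∘ suc)))
  byHead false y₀ = ++⁺ʳ (map _ (assignments n)) (++⁺ˡ (extend (λ _ → refl) (λ _ _ → refl) y₀ (assignments-complete n (y ∘ suc))))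

IntFeasible : (I : Instance) → (Fin (n I) → Bool) → Set
IntFeasible I y = ∀ j → load I (toℚ ∘ y) j ≤ 1ℚ

module _ (I : Instance) where

  intFeasibleᵇ-sound : ∀ y → intFeasibleᵇ I y ≡ true → IntFeasible I y
  intFeasibleᵇ-sound y = dec-true⁻¹ (all? (λ j → load I (toℚ ∘ y) j ≤? 1ℚ))

  OPT-≤ : ∀ {b} → 0ℚ ≤ b → (∀ y → IntFeasible I y → value I (toℚ ∘ y) ≤ b) → OPT I ≤ b
  OPT-≤ 0≤b value≤b = foldr-⊔-filter-≤ (intFeasibleᵇ I) (λ y → value I (toℚ ∘ y)) 0≤b
    (λ y feasible → value≤b y (intFeasibleᵇ-sound y feasible)) (assignments (n I))

  value≤OPT : ∀ y → IntFeasible I y → value I (toℚ ∘ y) ≤ OPT I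
  value≤OPT y feasible = ≤-foldr-⊔-filter (intFeasibleᵇ I) (λ z → value I (toℚ ∘ z)) (assignments (n I))
    (Any.map witness (assignments-complete (n I) y))
    where
    witness : ∀ {z} → z ≗ y → intFeasibleᵇ I z ≡ true × value I (toℚ ∘ y) ≤ value I (toℚ ∘ z)
    witness {z} z≗y =
      dec-true (all? (λ j → load I (toℚ ∘ z) j ≤? 1ℚ))
        (λ j → subst (_≤ 1ℚ) (sumF-cong (λ i → cong (λ b → s I j i * toℚ b) (sym (z≗y i)))) (feasible j)) ,
      ≤-reflexive (sumF-cong (λ i → cong (λ b → w I i * toℚ b) (sym (z≗y i))))

  weight≤OPT : ∀ a → (∀ j → s I j a ≤ 1ℚ) → w I a ≤ OPT I
  weight≤OPT a s≤1 = subst (_≤ OPT I) (sumF-select (w I) a)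
    (value≤OPT (λ i → does (i ≟ᶠ a)) (λ j → subst (_≤ 1ℚ) (sym (sumF-select (s I j) a)) (s≤1 j)))

module Cyclic (k′ : ℕ) (δ : ℚ) (0<δ : 0ℚ < δ) (δ≤½ : δ ≤ ½)
              (2k′δ≤1 : ℕ→ℚ (k′ ℕ.+ k′) * δ ≤ 1ℚ) where

  k M N : ℕ
  k = suc k′
  M = k′ ℕ.+ k′
  N = suc M

  inWindowᶠ : Fin N → Fin N → Bool
  inWindowᶠ i j = inWindowᵇ k (toℕ i) (toℕ j)

  entry : (diagonal inWindow : Bool) → ℚ
  entry true  _     = 1ℚ
  entry false true  = δ
  entry false false = 0ℚ

  size : Fin N → Fin N → ℚ
  size j i = entry (does (i ≟ᶠ j)) (inWindowᶠ i j)

  gapInstance : Instance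
  gapInstance = record { m = N ; n = N ; w = λ _ → 1ℚ ; s = size }

  entry-nonNeg : ∀ d b → 0ℚ ≤ entry d b
  entry-nonNeg true  _     = 0≤1
  entry-nonNeg false true  = <⇒≤ 0<δ
  entry-nonNeg false false = ≤-refl

  entry≤1 : ∀ d b → entry d b ≤ 1ℚ
  entry≤1 true  _     = ≤-refl
  entry≤1 false true  = ≤-trans δ≤½ ½≤1
  entry≤1 false false = 0≤1

  entry-offDiagonal≤δ : ∀ b → entry false b ≤ δ
  entry-offDiagonal≤δ true  = ≤-refl
  entry-offDiagonal≤δ false = <⇒≤ 0<δ

  entry≢0 : ∀ d b → not (does (entry d b ≟ 0ℚ)) ≡ true → d ≡ true ⊎ b ≡ true
  entry≢0 true  _     _ = inj₁ refl
  entry≢0 false true  _ = inj₂ refl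

  size-nonNeg : ∀ j i → 0ℚ ≤ size j i
  size-nonNeg j i = entry-nonNeg (does (i ≟ᶠ j)) (inWindowᶠ i j)

  size≤1 : ∀ j i → size j i ≤ 1ℚ
  size≤1 j i = entry≤1 (does (i ≟ᶠ j)) (inWindowᶠ i j)

  size-diagonal : ∀ j → size j j ≡ 1ℚ
  size-diagonal j rewrite dec-true (j ≟ᶠ j) refl = refl

  size-offDiagonal≤δ : ∀ j i → i ≢ j → size j i ≤ δ
  size-offDiagonal≤δ j i i≢j rewrite dec-false (i ≟ᶠ j) i≢j = entry-offDiagonal≤δ (inWindowᶠ i j)

  size-inWindow : ∀ j i → i ≢ j → InWindow k (toℕ i) (toℕ j) → size j i ≡ δ
  size-inWindow j i i≢j inW rewrite dec-false (i ≟ᶠ j) i≢j | dec-true (inWindow? k (toℕ i) (toℕ j)) inW = refl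

  size≢0⇒inWindow : ∀ j i → not (does (size j i ≟ 0ℚ)) ≡ true → inWindowᶠ i j ≡ true
  size≢0⇒inWindow j i size≢0 with entry≢0 (does (i ≟ᶠ j)) (inWindowᶠ i j) size≢0
  ... | inj₁ diagonal = dec-true (inWindow? k (toℕ i) (toℕ j))
          (subst (InWindow k (toℕ i) ∘ toℕ) (dec-true⁻¹ (i ≟ᶠ j) diagonal) (inWindow-refl k′ (toℕ i)))
  ... | inj₂ inWindow = inWindow

  kColumnSparse : KCSInstance k gapInstance
  kColumnSparse = (λ _ → 0≤1) , (λ j i → size-nonNeg j i , size≤1 j i) , columnCount
    where
    columnCount : ∀ i → countF (λ j → not (does (size j i ≟ 0ℚ))) ℕ.≤ k
    columnCount i = ℕ.≤-trans (countF-mono (λ j → size≢0⇒inWindow j i))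
      (ℕ.≤-trans (ℕ.≤-reflexive (countF≡countRange N 0 (inWindowᵇ k (toℕ i))))
                 (inWindow-count k′ (toℕ i) (toℕ<n i)))

  level : ℚ
  level = 1ℚ - ℕ→ℚ M * δ

  level-nonNeg : 0ℚ ≤ level
  level-nonNeg = subst (_≤ level) (+-inverseʳ (ℕ→ℚ M * δ)) (+-monoˡ-≤ (- (ℕ→ℚ M * δ)) 2k′δ≤1)

  level≤1 : level ≤ 1ℚ
  level≤1 = subst (level ≤_) (+-identityʳ 1ℚ)
    (+-monoʳ-≤ 1ℚ (neg-antimono-≤ (*-nonNeg (ℕ→ℚ-nonNeg M) (<⇒≤ 0<δ))))

  uniform : Fin N → ℚ
  uniform _ = level

  uniform-feasible : StrengthenedLPFeasible gapInstance uniform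
  uniform-feasible = (λ _ → level-nonNeg , level≤1) , load≤1 , bigLoad≤1
    where
    load≤1 : ∀ j → load gapInstance uniform j ≤ 1ℚ
    load≤1 j = ≤-trans (sumF-≤-except j own others)
      (≤-reflexive (solve 1 (λ x → (con 1ℚ :- x) :+ x := con 1ℚ) refl (ℕ→ℚ M * δ)))
      where
      open ℚ-Solver
      own : size j j * level ≤ level
      own = ≤-reflexive (trans (cong (_* level) (size-diagonal j)) (*-identityˡ level))
      others : ∀ i → i ≢ j → size j i * level ≤ δ
      others i i≢j = ≤-trans (*-monoˡ-≤-nonNeg (size j i) {{nonNegative (size-nonNeg j i)}} level≤1)
        (subst (_≤ δ) (sym (*-identityʳ (size j i))) (size-offDiagonal≤δ j i i≢j))

    bigLoad≤1 : ∀ j → bigLoad gapInstance uniform j ≤ 1ℚ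
    bigLoad≤1 j = ≤-trans (sumF-≤-except j (ifBig≤level (isBig gapInstance j j)) notBig)
      (subst (_≤ 1ℚ) (sym (trans (cong (level +_) (*-zeroʳ (ℕ→ℚ M))) (+-identityʳ level))) level≤1)
      where
      ifBig≤level : ∀ b → (if b then level else 0ℚ) ≤ level
      ifBig≤level true  = ≤-refl
      ifBig≤level false = level-nonNeg
      notBig : ∀ i → i ≢ j → (if isBig gapInstance j i then level else 0ℚ) ≤ 0ℚ
      notBig i i≢j rewrite dec-false (½ <? size j i) (λ ½<s → <⇒≱ ½<s (≤-trans (size-offDiagonal≤δ j i i≢j) δ≤½)) = ≤-refl

  value-uniform : value gapInstance uniform ≡ ℕ→ℚ N - ℕ→ℚ N * ℕ→ℚ M * δ
  value-uniform = trans (sumF-const N (1ℚ * level))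
    (solve 3 (λ q r d → q :* (con 1ℚ :* (con 1ℚ :- r :* d)) := q :- q :* r :* d) refl (ℕ→ℚ N) (ℕ→ℚ M) δ)
    where open ℚ-Solver

  inWindow-overfull : ∀ y → IntFeasible gapInstance y → ∀ {a b} → a ≢ b → InWindow k (toℕ a) (toℕ b) →
                      y a ≡ true → y b ≡ true → ⊥
  inWindow-overfull y feasible {a} {b} a≢b inW ya yb = <⇒≱ 1<load (feasible b)
    where
    f : Fin N → ℚ
    f i = size b i * toℚ (y i)
    1<load : 1ℚ < load gapInstance (toℚ ∘ y) b
    1<load = begin-strict
      1ℚ        ≡⟨ +-identityʳ 1ℚ ⟨
      1ℚ + 0ℚ   <⟨ +-monoʳ-< 1ℚ 0<δ ⟩
      1ℚ + δ    ≡⟨ cong₂ _+_ (cong₂ _*_ (size-diagonal b) (cong toℚ yb))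
                             (trans (cong₂ _*_ (size-inWindow b a a≢b inW) (cong toℚ ya)) (*-identityʳ δ)) ⟨
      f b + f a ≤⟨ sumF-≥-pair (λ i → *-nonNeg (size-nonNeg b i) (toℚ-nonNeg (y i))) (a≢b ∘ sym) ⟩
      sumF f    ∎
      where open ≤-Reasoning

  feasible⇒atMostOne : ∀ y → IntFeasible gapInstance y → AtMostOne y
  feasible⇒atMostOne y feasible a b ya yb with a ≟ᶠ b
  ... | yes a≡b = a≡b
  ... | no  a≢b with inWindow-either k (a≢b ∘ toℕ-injective)
  ...   | inj₁ a∈b = ⊥-elim (inWindow-overfull y feasible a≢b a∈b ya yb)
  ...   | inj₂ b∈a = ⊥-elim (inWindow-overfull y feasible (a≢b ∘ sym) b∈a yb ya)

  OPT≡1 : OPT gapInstance ≡ 1ℚ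
  OPT≡1 = ≤-antisym
    (OPT-≤ gapInstance 0≤1 λ y feasible → subst (_≤ 1ℚ) (sumF-cong (λ i → sym (*-identityˡ (toℚ (y i)))))
      (sumF-atMostOne y (feasible⇒atMostOne y feasible)))
    (weight≤OPT gapInstance zero (λ j → size≤1 j zero))

  uniform-gap : ∀ {ε} → ℕ→ℚ N * ℕ→ℚ M * δ ≤ ε →
                (ℕ→ℚ N - ε) * OPT gapInstance ≤ value gapInstance uniform
  uniform-gap {ε} NRδ≤ε = begin
    (ℕ→ℚ N - ε) * OPT gapInstance                ≡⟨ cong ((ℕ→ℚ N - ε) *_) OPT≡1 ⟩
    (ℕ→ℚ N - ε) * 1ℚ                             ≡⟨ *-identityʳ (ℕ→ℚ N - ε) ⟩
    ℕ→ℚ N - ε                                    ≤⟨ +-monoʳ-≤ (ℕ→ℚ N) (neg-antimono-≤ NRδ≤ε) ⟩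
    ℕ→ℚ N - ℕ→ℚ N * ℕ→ℚ M * δ                    ≡⟨ value-uniform ⟨
    value gapInstance uniform                    ∎
    where open ≤-Reasoning

-- δ = u / (1 + a) splits u as δ + a δ.
small-δ : ∀ {a u} → 0ℚ ≤ a → 0ℚ < u → Σ ℚ λ δ → 0ℚ < δ × δ ≤ u × a * δ ≤ u
small-δ {a} {u} 0≤a 0<u =
  δ , 0<δ , subst (δ ≤_) (sym u≡δ+aδ) (p≤p+q δ 0≤aδ) , subst (a * δ ≤_) (sym u≡δ+aδ) (p≤q+p (a * δ) (<⇒≤ 0<δ))
  where
  instance
    1+a-pos : Positive (1ℚ + a)
    1+a-pos = pos+nonNeg⇒pos 1ℚ a {{nonNegative 0≤a}}
    1+a-nonZero : NonZero (1ℚ + a)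
    1+a-nonZero = pos⇒nonZero (1ℚ + a)
  δ : ℚ
  δ = u * 1/ (1ℚ + a)
  0<δ : 0ℚ < δ
  0<δ = positive⁻¹ δ {{pos*pos⇒pos u {{positive 0<u}} (1/ (1ℚ + a)) {{1/pos⇒pos (1ℚ + a)}}}}
  0≤aδ : 0ℚ ≤ a * δ
  0≤aδ = *-nonNeg 0≤a (<⇒≤ 0<δ)
  u≡δ+aδ : u ≡ δ + a * δ
  u≡δ+aδ = begin
    u                            ≡⟨ *-identityʳ u ⟨
    u * 1ℚ                       ≡⟨ cong (u *_) (*-inverseʳ (1ℚ + a)) ⟨
    u * ((1ℚ + a) * 1/ (1ℚ + a)) ≡⟨ solve 3 (λ u a r → u :* ((con 1ℚ :+ a) :* r) := u :* r :+ a :* (u :* r))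
                                          refl u a (1/ (1ℚ + a)) ⟩
    δ + a * δ                    ∎
    where open ≡-Reasoning; open ℚ-Solver

mainTheorem3 : (k : ℕ) → 1 Data.Nat.≤ k → (ε : ℚ) → 0ℚ < ε →
    Σ Instance λ I → KCSInstance k I × (0ℚ < OPT I ×
    Σ (Fin (n I) → ℚ) λ x → StrengthenedLPFeasible I x ×
    ((ℕ→ℚ (2 Data.Nat.* k ∸ 1) - ε) * OPT I ≤ value I x))
mainTheorem3 (suc k′) _ ε 0<ε =
  gapInstance , kColumnSparse , subst (0ℚ <_) (sym OPT≡1) (positive⁻¹ 1ℚ) , uniform , uniform-feasible ,
  subst (λ m → (ℕ→ℚ m - ε) * OPT gapInstance ≤ value gapInstance uniform) (sym (2*[1+n]∸1≡1+n+n k′))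
        (uniform-gap (≤-trans NRδ≤ε⊓½ (p⊓q≤p ε ½)))
  where
  N R δ : ℚ
  N = ℕ→ℚ (suc (k′ ℕ.+ k′))
  R = ℕ→ℚ (k′ ℕ.+ k′)
  choice : Σ ℚ λ δ → 0ℚ < δ × δ ≤ ε ⊓ ½ × N * R * δ ≤ ε ⊓ ½
  choice = small-δ (*-nonNeg (ℕ→ℚ-nonNeg (suc (k′ ℕ.+ k′))) (ℕ→ℚ-nonNeg (k′ ℕ.+ k′))) (0<⊓ 0<ε (positive⁻¹ ½))
  δ = proj₁ choice
  NRδ≤ε⊓½ : N * R * δ ≤ ε ⊓ ½
  NRδ≤ε⊓½ = proj₂ (proj₂ (proj₂ choice))
  Rδ≤1 : R * δ ≤ 1ℚ
  Rδ≤1 = begin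
    R * δ       ≤⟨ p≤q*p (*-nonNeg (ℕ→ℚ-nonNeg (k′ ℕ.+ k′)) (<⇒≤ (proj₁ (proj₂ choice)))) (1≤ℕ→ℚ-suc (k′ ℕ.+ k′)) ⟩
    N * (R * δ) ≡⟨ *-assoc N R δ ⟨
    N * R * δ   ≤⟨ ≤-trans NRδ≤ε⊓½ (p⊓q≤q ε ½) ⟩
    ½           ≤⟨ ½≤1 ⟩
    1ℚ          ∎
    where open ≤-Reasoning
  open Cyclic k′ δ (proj₁ (proj₂ choice)) (≤-trans (proj₁ (proj₂ (proj₂ choice))) (p⊓q≤q ε ½)) Rδ≤1
    using (gapInstance; kColumnSparse; OPT≡1; uniform; uniform-feasible; uniform-gap)
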